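{- Let $\vec U$ be a universe with a submodular order function and $P$ and $P'$ two profiles in $\vec U$. If $\vec r,\vec s\in P$ distinguish $P$ and $P'$ efficiently, then both $\vec r\lor\vec s$ and $\vec r\land\vec s$ also lie in $P$ and distinguish $P$ and $P'$ efficiently.
   Context: A universe is a poset with an order-reversing involution $\vec s\mapsto\overleftarrow s$ which is a lattice ($\lor$, $\land$); $s=\{\vec s,\overleftarrow s\}$. An order function is $|\cdot|\colon\vec U\to\mathbb{N}_0$ with $|\vec s|=|\overleftarrow s|=:|s|$; submodular means $|\vec s|+|\vec t|\ge|\vec s\lor\vec t|+|\vec s\land\vec t|$ for all $\vec s,\vec t$. For $k\in\mathbb{N}\cup\{\aleph_0\}$, $S_k$ is the set of $s\in U$ with $|s|<k$. An orientation of a set $S$ of unoriented separations contains exactly one of $\vec s,\overleftarrow s$ for each $s\in S$; it is consistent if it contains no $\vec r,\vec s$ with $r\ne s$ and $\overleftarrow r\le\vec s$. A profile in $\vec U$ is a consistent orientation $P$ of some $S_k$ with $(\overleftarrow r\land\overleftarrow s)\notin P$ for all $\vec r,\vec s\in P$. A separation $s$ distinguishes $P,P'$ if $\vec s\in P$ and $\overleftarrow s\in P'$ for a suitable orientation; efficiently if $|s|$ is minimal among all separations distinguishing them. -}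

module Defs where

open import Level using (0ℓ)
open import Data.Nat using (ℕ; _≤_; _<_; _+_)
open import Data.Product using (_×_; ∃; Σ; _,_)
open import Data.Sum using (_⊎_)
open import Data.Unit using (⊤)
open import Data.Empty using (⊥)
open import Relation.Nullary using (¬_)
open import Relation.Binary.Core using (Rel)
open import Relation.Binary.PropositionalEquality using (_≡_)
open import Relation.Binary.Lattice.Structures using (IsLattice)

record Universe : Set₁ where
  infixr 6 _∨_
  infixr 7 _∧_
  field
    U         : Set
    _≤ᵤ_      : Rel U 0ℓ
    _∨_       : U → U → U
    _∧_       : U → U → U
    isLattice : IsLattice _≡_ _≤ᵤ_ _∨_ _∧_
    _*        : U → U
    *-invol   : ∀ x → (x *) * ≡ x
    *-rev     : ∀ {x y} → x ≤ᵤ y → (y *) ≤ᵤ (x *)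

module _ (𝕌 : Universe) where
  open Universe 𝕌

  record OrderFunction : Set where
    field
      ∣_∣   : U → ℕ
      ∣*∣   : ∀ x → ∣ x * ∣ ≡ ∣ x ∣

  Submodular : OrderFunction → Set
  Submodular o = ∀ x y → ∣ x ∨ y ∣ + ∣ x ∧ y ∣ ≤ ∣ x ∣ + ∣ y ∣
    where open OrderFunction o

data ℕ∞ : Set where
  fin : ℕ → ℕ∞
  ℵ₀  : ℕ∞

_<∞_ : ℕ → ℕ∞ → Set
n <∞ fin k = n < k
n <∞ ℵ₀    = ⊤

module Separations (𝕌 : Universe) (o : OrderFunction 𝕌) where
  open Universe 𝕌
  open OrderFunction o

  Pred : Set₁
  Pred = U → Set

  -- unoriented separations {x, x*} and {y, y*} are equal
  SameSep : U → U → Set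
  SameSep x y = (x ≡ y) ⊎ (x ≡ y *)

  -- the separation s = {x, x*} lies in S_k (recall |x| = |x*|)
  InS : ℕ∞ → U → Set
  InS k x = ∣ x ∣ <∞ k

  IsOrientationOf : ℕ∞ → Pred → Set
  IsOrientationOf k P =
      (∀ x → P x → InS k x)
    × (∀ x → InS k x → P x ⊎ P (x *))
    × (∀ x → P x → P (x *) → ⊥)

  Consistent : Pred → Set
  Consistent P = ∀ r s → P r → P s → ¬ SameSep r s → ¬ ((r *) ≤ᵤ s)

  IsProfile : Pred → Set
  IsProfile P =
      ∃ (λ k → IsOrientationOf k P)
    × Consistent P
    × (∀ r s → P r → P s → ¬ P ((r *) ∧ (s *)))

  Distinguishes : Pred → Pred → U → Set
  Distinguishes P P' x = (P x × P' (x *)) ⊎ (P (x *) × P' x)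

  DistinguishesEfficiently : Pred → Pred → U → Set
  DistinguishesEfficiently P P' x =
    Distinguishes P P' x × (∀ y → Distinguishes P P' y → ∣ x ∣ ≤ ∣ y ∣)

module Submission where

open import Defs
open import Data.Product using (_×_; _,_; proj₁; proj₂)
open import Data.Sum using (inj₁; inj₂)
open import Data.Empty using (⊥-elim)
open import Data.Nat using (_≤_; _+_)
open import Data.Nat.Properties using (≤-total; ≤-trans; ≤-<-trans; +-monoˡ-≤; +-monoʳ-≤; +-cancelˡ-≤; +-comm)
open import Relation.Nullary using (¬_)
open import Relation.Binary.PropositionalEquality using (_≡_; refl; sym; trans; cong; cong₂; subst; subst₂; module ≡-Reasoning)
open import Relation.Binary.Lattice.Structures using (IsLattice)

-- By submodularity |r ∨ s| + |r ∧ s| ≤ 2|r|, so one of the two corners has order at most |r|.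
-- A corner of order at most |r| lies in P and its inverse in P' (profiles are closed under ∨,
-- consistent orientations under ∧, and (r ∨ s)* = r* ∧ s*), so it distinguishes P and P'.
-- By efficiency of r its order is then exactly |r|, which forces the other corner to have
-- order at most |r| as well.

o≤m⇒m+n≤o+o⇒n≤o : ∀ {m n o} → o ≤ m → m + n ≤ o + o → n ≤ o
o≤m⇒m+n≤o+o⇒n≤o {m} {n} {o} o≤m m+n≤o+o = +-cancelˡ-≤ o n o (≤-trans (+-monoˡ-≤ n o≤m) m+n≤o+o)

both-≤-of-+-≤ : ∀ {m n o} → m + n ≤ o + o → (m ≤ o → o ≤ m) → (n ≤ o → o ≤ n) → m ≤ o × n ≤ o
both-≤-of-+-≤ {m} {n} {o} m+n≤o+o m-minimal n-minimal with ≤-total m o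
... | inj₁ m≤o = m≤o , o≤m⇒m+n≤o+o⇒n≤o (m-minimal m≤o) m+n≤o+o
... | inj₂ o≤m = o≤m⇒m+n≤o+o⇒n≤o (n-minimal n≤o) n+m≤o+o , n≤o
  where
  n≤o : n ≤ o
  n≤o = o≤m⇒m+n≤o+o⇒n≤o o≤m m+n≤o+o
  n+m≤o+o : n + m ≤ o + o
  n+m≤o+o = subst (_≤ o + o) (+-comm m n) m+n≤o+o

module DeMorgan (𝕌 : Universe) where
  open Universe 𝕌
  open IsLattice isLattice using (x≤x∨y; y≤x∨y; ∨-least; x∧y≤x; x∧y≤y; ∧-greatest; antisym)

  ≤-*-swap : ∀ {x y} → x ≤ᵤ (y *) → y ≤ᵤ (x *)
  ≤-*-swap {x} {y} x≤y* = subst (_≤ᵤ (x *)) (*-invol y) (*-rev x≤y*)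

  ∨-* : ∀ x y → (x ∨ y) * ≡ x * ∧ y *
  ∨-* x y = antisym
    (∧-greatest (*-rev (x≤x∨y x y)) (*-rev (y≤x∨y x y)))
    (≤-*-swap (∨-least (≤-*-swap (x∧y≤x (x *) (y *))) (≤-*-swap (x∧y≤y (x *) (y *)))))

  ∧-* : ∀ x y → (x ∧ y) * ≡ x * ∨ y *
  ∧-* x y = begin
    (x ∧ y) *                 ≡⟨ cong _* (cong₂ _∧_ (sym (*-invol x)) (sym (*-invol y))) ⟩
    ((x *) * ∧ (y *) *) *     ≡⟨ cong _* (sym (∨-* (x *) (y *))) ⟩
    ((x * ∨ y *) *) *         ≡⟨ *-invol _ ⟩
    x * ∨ y *                 ∎
    where open ≡-Reasoning

module Profiles (𝕌 : Universe) (o : OrderFunction 𝕌) where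
  open Universe 𝕌
  open OrderFunction o
  open Separations 𝕌 o
  open DeMorgan 𝕌
  open IsLattice isLattice using (x∧y≤x; x∧y≤y; ∧-greatest; antisym; reflexive)

  ∣*∣-mono : ∀ {x y} → ∣ x ∣ ≤ ∣ y ∣ → ∣ x * ∣ ≤ ∣ y * ∣
  ∣*∣-mono {x} {y} = subst₂ _≤_ (sym (∣*∣ x)) (sym (∣*∣ y))

  InS-mono : ∀ {k x y} → ∣ x ∣ ≤ ∣ y ∣ → InS k y → InS k x
  InS-mono {fin k} x≤y y<k = ≤-<-trans x≤y y<k
  InS-mono {ℵ₀}    _   _   = _

  ∈S-of-≤ : ∀ {k P x y} → IsOrientationOf k P → P y → ∣ x ∣ ≤ ∣ y ∣ → InS k x
  ∈S-of-≤ (bounded , _) Py x≤y = InS-mono x≤y (bounded _ Py)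

  ∨-closed : ∀ {k P} → IsOrientationOf k P → (∀ r s → P r → P s → ¬ P ((r *) ∧ (s *))) →
             ∀ {x y} → P x → P y → InS k (x ∨ y) → P (x ∨ y)
  ∨-closed {P = P} (_ , total , _) no-co-meet {x} {y} Px Py x∨y∈S with total (x ∨ y) x∨y∈S
  ... | inj₁ Px∨y    = Px∨y
  ... | inj₂ P[x∨y]* = ⊥-elim (no-co-meet x y Px Py (subst P (∨-* x y) P[x∨y]*))

  ∧-closed : ∀ {k P} → IsOrientationOf k P → Consistent P →
             ∀ {x y} → P x → P y → InS k (x ∧ y) → P (x ∧ y)
  ∧-closed {P = P} (_ , total , exclusive) consistent {x} {y} Px Py x∧y∈S with total (x ∧ y) x∧y∈S
  ... | inj₁ Px∧y    = Px∧y
  ... | inj₂ P[x∧y]* =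
    ⊥-elim (consistent ((x ∧ y) *) x P[x∧y]* Px distinct (subst (_≤ᵤ x) (sym (*-invol _)) (x∧y≤x x y)))
    where
    -- If (x ∧ y)* = x then x* = x ∧ y ≤ y, which consistency forbids for x, y ∈ P.
    distinct : ¬ SameSep ((x ∧ y) *) x
    distinct (inj₂ [x∧y]*≡x*) = exclusive x Px (subst P [x∧y]*≡x* P[x∧y]*)
    distinct (inj₁ [x∧y]*≡x)  = consistent x y Px Py x≢y x*≤y
      where
      x*≡x∧y : x * ≡ x ∧ y
      x*≡x∧y = trans (cong _* (sym [x∧y]*≡x)) (*-invol _)

      x*≤y : (x *) ≤ᵤ y
      x*≤y = subst (_≤ᵤ y) (sym x*≡x∧y) (x∧y≤y x y)

      x≢y : ¬ SameSep x y
      x≢y (inj₁ x≡y)  = exclusive x Px (subst P (sym x*≡x) Px)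
        where
        x*≡x : x * ≡ x
        x*≡x = trans x*≡x∧y (antisym (x∧y≤x x y) (∧-greatest (reflexive refl) (reflexive x≡y)))
      x≢y (inj₂ x≡y*) = exclusive y Py (subst P x≡y* Px)

  inverse-∈-other : ∀ {k P P' x} → IsOrientationOf k P → P x → Distinguishes P P' x → P' (x *)
  inverse-∈-other _                   _  (inj₁ (_ , P'x*)) = P'x*
  inverse-∈-other (_ , _ , exclusive) Px (inj₂ (Px* , _))  = ⊥-elim (exclusive _ Px Px*)

  efficient-of-≤ : ∀ {P P' x y} → DistinguishesEfficiently P P' x →
                   Distinguishes P P' y → ∣ y ∣ ≤ ∣ x ∣ → DistinguishesEfficiently P P' y
  efficient-of-≤ (_ , x-minimal) dy y≤x = dy , λ z dz → ≤-trans y≤x (x-minimal z dz)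

  ∨-separates : ∀ {P P'} → IsProfile P → IsProfile P' → ∀ {r s} → P r → P s → P' (r *) → P' (s *) →
                ∣ r ∨ s ∣ ≤ ∣ r ∣ → P (r ∨ s) × P' ((r ∨ s) *)
  ∨-separates {P' = P'} ((_ , orP) , _ , no-co-meetP) ((_ , orP') , consistentP' , _) {r} {s}
              Pr Ps P'r* P's* small =
    ∨-closed orP no-co-meetP Pr Ps (∈S-of-≤ orP Pr small) ,
    subst P' (sym (∨-* r s))
      (∧-closed orP' consistentP' P'r* P's*
        (∈S-of-≤ orP' P'r* (subst (_≤ ∣ r * ∣) (cong ∣_∣ (∨-* r s)) (∣*∣-mono small))))

  ∧-separates : ∀ {P P'} → IsProfile P → IsProfile P' → ∀ {r s} → P r → P s → P' (r *) → P' (s *) →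
                ∣ r ∧ s ∣ ≤ ∣ r ∣ → P (r ∧ s) × P' ((r ∧ s) *)
  ∧-separates {P' = P'} ((_ , orP) , consistentP , _) ((_ , orP') , _ , no-co-meetP') {r} {s}
              Pr Ps P'r* P's* small =
    ∧-closed orP consistentP Pr Ps (∈S-of-≤ orP Pr small) ,
    subst P' (sym (∧-* r s))
      (∨-closed orP' no-co-meetP' P'r* P's*
        (∈S-of-≤ orP' P'r* (subst (_≤ ∣ r * ∣) (cong ∣_∣ (∧-* r s)) (∣*∣-mono small))))

lemma2p5 : (𝕌 : Universe) (o : OrderFunction 𝕌) → Submodular 𝕌 o →
    (P P' : Separations.Pred 𝕌 o) →
    Separations.IsProfile 𝕌 o P → Separations.IsProfile 𝕌 o P' →
    (r s : Universe.U 𝕌) → P r → P s →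
    Separations.DistinguishesEfficiently 𝕌 o P P' r →
    Separations.DistinguishesEfficiently 𝕌 o P P' s →
    (P (Universe._∨_ 𝕌 r s) × Separations.DistinguishesEfficiently 𝕌 o P P' (Universe._∨_ 𝕌 r s))
      × (P (Universe._∧_ 𝕌 r s) × Separations.DistinguishesEfficiently 𝕌 o P P' (Universe._∧_ 𝕌 r s))
lemma2p5 𝕌 o submodular P P' prP@((_ , orP) , _) prP' r s Pr Ps er@(r-distinguishes , r-minimal) es =
  let ∨-small , ∧-small = orders in
  (proj₁ (∨-sep ∨-small) , efficient-of-≤ er (inj₁ (∨-sep ∨-small)) ∨-small) ,
  (proj₁ (∧-sep ∧-small) , efficient-of-≤ er (inj₁ (∧-sep ∧-small)) ∧-small)
  where
  open Universe 𝕌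
  open OrderFunction o
  open Profiles 𝕌 o

  P'r* : P' (r *)
  P'r* = inverse-∈-other {P' = P'} orP Pr r-distinguishes

  P's* : P' (s *)
  P's* = inverse-∈-other {P' = P'} orP Ps (proj₁ es)

  ∨-sep : ∣ r ∨ s ∣ ≤ ∣ r ∣ → P (r ∨ s) × P' ((r ∨ s) *)
  ∨-sep = ∨-separates prP prP' Pr Ps P'r* P's*

  ∧-sep : ∣ r ∧ s ∣ ≤ ∣ r ∣ → P (r ∧ s) × P' ((r ∧ s) *)
  ∧-sep = ∧-separates prP prP' Pr Ps P'r* P's*

  s≤r : ∣ s ∣ ≤ ∣ r ∣
  s≤r = proj₂ es r r-distinguishes

  orders : ∣ r ∨ s ∣ ≤ ∣ r ∣ × ∣ r ∧ s ∣ ≤ ∣ r ∣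
  orders = both-≤-of-+-≤
    (≤-trans (submodular r s) (+-monoʳ-≤ ∣ r ∣ s≤r))
    (λ small → r-minimal _ (inj₁ (∨-sep small)))
    (λ small → r-minimal _ (inj₁ (∧-sep small)))
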